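{- Provability in $\mathsf{G4CK}$ and in $\mathsf{G4WK}$ is decidable: for $\mathsf{S}\in\{\mathsf{G4CK},\mathsf{G4WK}\}$ there is an algorithm that, given any sequent of $\mathsf{S}$, decides whether it is derivable in $\mathsf{S}$.
   Context: Formulas are built from a countably infinite set $\mathsf{Prop}$ of propositional variables by $\varphi ::= p \mid \bot \mid \varphi\wedge\varphi \mid \varphi\vee\varphi \mid \varphi\to\varphi \mid \Box\varphi \mid \Diamond\varphi$. For a multiset $\Gamma$, $\Box^{ -1}\Gamma=\{\varphi\mid\Box\varphi\in\Gamma\}$ and $\Diamond^{ -1}\Gamma=\{\varphi\mid\Diamond\varphi\in\Gamma\}$ (with multiplicities). A sequent is $\Gamma\Rightarrow\Delta$ with $\Gamma,\Delta$ finite multisets of formulas; $\Gamma,\varphi$ means $\Gamma\uplus\{\varphi\}$; a single formula on the right denotes a singleton. In $\mathsf{G4CK}$ succedents have exactly one element; in $\mathsf{G4WK}$ at most one. Common rules ($p\in\mathsf{Prop}$, $\Delta$ an allowed succedent): ($\bot$L) $\Gamma,\bot\Rightarrow\Delta$ (no premises); (IdP) $\Gamma,p\Rightarrow p$ (no premises); ($\wedge$L) from $\Gamma,\varphi,\psi\Rightarrow\Delta$ infer $\Gamma,\varphi\wedge\psi\Rightarrow\Delta$; ($\wedge$R) from $\Gamma\Rightarrow\varphi$, $\Gamma\Rightarrow\psi$ infer $\Gamma\Rightarrow\varphi\wedge\psi$; ($\vee$L) from $\Gamma,\varphi\Rightarrow\Delta$, $\Gamma,\psi\Rightarrow\Delta$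 infer $\Gamma,\varphi\vee\psi\Rightarrow\Delta$; ($\vee$R$_i$) from $\Gamma\Rightarrow\varphi_i$ infer $\Gamma\Rightarrow\varphi_1\vee\varphi_2$; ($\to$R) from $\Gamma,\varphi\Rightarrow\psi$ infer $\Gamma\Rightarrow\varphi\to\psi$; ($\wedge\!\to$L) from $\Gamma,\varphi\to(\psi\to\chi)\Rightarrow\Delta$ infer $\Gamma,(\varphi\wedge\psi)\to\chi\Rightarrow\Delta$; ($\vee\!\to$L) from $\Gamma,\varphi\to\chi,\psi\to\chi\Rightarrow\Delta$ infer $\Gamma,(\varphi\vee\psi)\to\chi\Rightarrow\Delta$; ($p\!\to$L) from $\Gamma,p,\varphi\Rightarrow\Delta$ infer $\Gamma,p,p\to\varphi\Rightarrow\Delta$; ($\to\to$L) from $\Gamma,\psi\to\chi\Rightarrow\varphi\to\psi$ and $\Gamma,\chi\Rightarrow\Delta$ infer $\Gamma,(\varphi\to\psi)\to\chi\Rightarrow\Delta$; ($\Box$R) from $\Box^{ -1}\Gamma\Rightarrow\varphi$ infer $\Gamma\Rightarrow\Box\varphi$; ($\Box\!\to$L) from $\Box^{ -1}\Gamma\Rightarrow\varphi$ and $\Gamma,\psi\Rightarrow\Delta$ infer $\Gamma,\Box\varphi\to\psi\Rightarrow\Delta$; ($\Diamond\!\to$L) from $\Box^{ -1}\Gamma,\gamma\Rightarrow\varphi$ and $\Gamma,\Diamond\gamma,\psi\Rightarrow\Delta$ infer $\Gamma,\Diamond\gamma,\Diamond\varphi\to\psi\Rightarrow\Delta$. $\mathsf{G4CK}$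 additionally has ($\Diamond$L): from $\Box^{ -1}\Gamma,\varphi\Rightarrow\psi$ infer $\Gamma,\Diamond\varphi\Rightarrow\Diamond\psi$; $\mathsf{G4WK}$ instead has ($\Diamond$L$'$): from $\Box^{ -1}\Gamma,\varphi\Rightarrow\Diamond^{ -1}\Delta$ infer $\Gamma,\Diamond\varphi\Rightarrow\Delta$. A sequent is derivable if it has a finite derivation tree in these rules. -}

module Defs where

open import Data.Nat using (ℕ)
open import Data.List using (List; []; _∷_)
open import Data.Maybe using (Maybe; just; nothing)
open import Data.List.Relation.Binary.Permutation.Propositional using (_↭_)

data Fml : Set where
  var  : ℕ → Fml
  ⊥'   : Fml
  _∧'_ : Fml → Fml → Fml
  _∨'_ : Fml → Fml → Fml
  _⇒_  : Fml → Fml → Fml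
  □_   : Fml → Fml
  ◇_   : Fml → Fml

infixr 6 _∧'_
infixr 5 _∨'_
infixr 4 _⇒_

-- Multisets are represented by lists; every rule's conclusion is taken up to
-- permutation (Γ₀ ↭ ...), so derivability depends only on the multiset.

boxInv : List Fml → List Fml
boxInv []          = []
boxInv ((□ φ) ∷ Γ) = φ ∷ boxInv Γ
boxInv (_ ∷ Γ)     = boxInv Γ

diaInv : Maybe Fml → Maybe Fml
diaInv (just (◇ φ)) = just φ
diaInv _            = nothing

data G4CK : List Fml → Fml → Set where
  ⊥L   : ∀ {Γ₀ Γ Δ} → Γ₀ ↭ (⊥' ∷ Γ) → G4CK Γ₀ Δ
  IdP  : ∀ {Γ₀ Γ p} → Γ₀ ↭ (var p ∷ Γ) → G4CK Γ₀ (var p)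
  ∧L   : ∀ {Γ₀ Γ φ ψ Δ} → Γ₀ ↭ ((φ ∧' ψ) ∷ Γ) →
         G4CK (φ ∷ ψ ∷ Γ) Δ → G4CK Γ₀ Δ
  ∧R   : ∀ {Γ φ ψ} → G4CK Γ φ → G4CK Γ ψ → G4CK Γ (φ ∧' ψ)
  ∨L   : ∀ {Γ₀ Γ φ ψ Δ} → Γ₀ ↭ ((φ ∨' ψ) ∷ Γ) →
         G4CK (φ ∷ Γ) Δ → G4CK (ψ ∷ Γ) Δ → G4CK Γ₀ Δ
  ∨R₁  : ∀ {Γ φ ψ} → G4CK Γ φ → G4CK Γ (φ ∨' ψ)
  ∨R₂  : ∀ {Γ φ ψ} → G4CK Γ ψ → G4CK Γ (φ ∨' ψ)
  ⇒R   : ∀ {Γ φ ψ} → G4CK (φ ∷ Γ) ψ → G4CK Γ (φ ⇒ ψ)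
  ∧⇒L  : ∀ {Γ₀ Γ φ ψ χ Δ} → Γ₀ ↭ (((φ ∧' ψ) ⇒ χ) ∷ Γ) →
         G4CK ((φ ⇒ (ψ ⇒ χ)) ∷ Γ) Δ → G4CK Γ₀ Δ
  ∨⇒L  : ∀ {Γ₀ Γ φ ψ χ Δ} → Γ₀ ↭ (((φ ∨' ψ) ⇒ χ) ∷ Γ) →
         G4CK ((φ ⇒ χ) ∷ (ψ ⇒ χ) ∷ Γ) Δ → G4CK Γ₀ Δ
  p⇒L  : ∀ {Γ₀ Γ p φ Δ} → Γ₀ ↭ (var p ∷ (var p ⇒ φ) ∷ Γ) →
         G4CK (var p ∷ φ ∷ Γ) Δ → G4CK Γ₀ Δ
  ⇒⇒L  : ∀ {Γ₀ Γ φ ψ χ Δ} → Γ₀ ↭ (((φ ⇒ ψ) ⇒ χ) ∷ Γ) →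
         G4CK ((ψ ⇒ χ) ∷ Γ) (φ ⇒ ψ) → G4CK (χ ∷ Γ) Δ → G4CK Γ₀ Δ
  □R   : ∀ {Γ φ} → G4CK (boxInv Γ) φ → G4CK Γ (□ φ)
  □⇒L  : ∀ {Γ₀ Γ φ ψ Δ} → Γ₀ ↭ ((□ φ ⇒ ψ) ∷ Γ) →
         G4CK (boxInv Γ) φ → G4CK (ψ ∷ Γ) Δ → G4CK Γ₀ Δ
  ◇⇒L  : ∀ {Γ₀ Γ γ φ ψ Δ} → Γ₀ ↭ ((◇ γ) ∷ (◇ φ ⇒ ψ) ∷ Γ) →
         G4CK (γ ∷ boxInv Γ) φ → G4CK ((◇ γ) ∷ ψ ∷ Γ) Δ → G4CK Γ₀ Δ
  ◇L   : ∀ {Γ₀ Γ φ ψ} → Γ₀ ↭ ((◇ φ) ∷ Γ) →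
         G4CK (φ ∷ boxInv Γ) ψ → G4CK Γ₀ (◇ ψ)

-- G4WK : succedent at most one formula (nothing = empty succedent)

data G4WK : List Fml → Maybe Fml → Set where
  ⊥L   : ∀ {Γ₀ Γ Δ} → Γ₀ ↭ (⊥' ∷ Γ) → G4WK Γ₀ Δ
  IdP  : ∀ {Γ₀ Γ p} → Γ₀ ↭ (var p ∷ Γ) → G4WK Γ₀ (just (var p))
  ∧L   : ∀ {Γ₀ Γ φ ψ Δ} → Γ₀ ↭ ((φ ∧' ψ) ∷ Γ) →
         G4WK (φ ∷ ψ ∷ Γ) Δ → G4WK Γ₀ Δ
  ∧R   : ∀ {Γ φ ψ} → G4WK Γ (just φ) → G4WK Γ (just ψ) → G4WK Γ (just (φ ∧' ψ))
  ∨L   : ∀ {Γ₀ Γ φ ψ Δ} → Γ₀ ↭ ((φ ∨' ψ) ∷ Γ) →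
         G4WK (φ ∷ Γ) Δ → G4WK (ψ ∷ Γ) Δ → G4WK Γ₀ Δ
  ∨R₁  : ∀ {Γ φ ψ} → G4WK Γ (just φ) → G4WK Γ (just (φ ∨' ψ))
  ∨R₂  : ∀ {Γ φ ψ} → G4WK Γ (just ψ) → G4WK Γ (just (φ ∨' ψ))
  ⇒R   : ∀ {Γ φ ψ} → G4WK (φ ∷ Γ) (just ψ) → G4WK Γ (just (φ ⇒ ψ))
  ∧⇒L  : ∀ {Γ₀ Γ φ ψ χ Δ} → Γ₀ ↭ (((φ ∧' ψ) ⇒ χ) ∷ Γ) →
         G4WK ((φ ⇒ (ψ ⇒ χ)) ∷ Γ) Δ → G4WK Γ₀ Δ
  ∨⇒L  : ∀ {Γ₀ Γ φ ψ χ Δ} → Γ₀ ↭ (((φ ∨' ψ) ⇒ χ) ∷ Γ) →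
         G4WK ((φ ⇒ χ) ∷ (ψ ⇒ χ) ∷ Γ) Δ → G4WK Γ₀ Δ
  p⇒L  : ∀ {Γ₀ Γ p φ Δ} → Γ₀ ↭ (var p ∷ (var p ⇒ φ) ∷ Γ) →
         G4WK (var p ∷ φ ∷ Γ) Δ → G4WK Γ₀ Δ
  ⇒⇒L  : ∀ {Γ₀ Γ φ ψ χ Δ} → Γ₀ ↭ (((φ ⇒ ψ) ⇒ χ) ∷ Γ) →
         G4WK ((ψ ⇒ χ) ∷ Γ) (just (φ ⇒ ψ)) → G4WK (χ ∷ Γ) Δ → G4WK Γ₀ Δ
  □R   : ∀ {Γ φ} → G4WK (boxInv Γ) (just φ) → G4WK Γ (just (□ φ))
  □⇒L  : ∀ {Γ₀ Γ φ ψ Δ} → Γ₀ ↭ ((□ φ ⇒ ψ) ∷ Γ) →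
         G4WK (boxInv Γ) (just φ) → G4WK (ψ ∷ Γ) Δ → G4WK Γ₀ Δ
  ◇⇒L  : ∀ {Γ₀ Γ γ φ ψ Δ} → Γ₀ ↭ ((◇ γ) ∷ (◇ φ ⇒ ψ) ∷ Γ) →
         G4WK (γ ∷ boxInv Γ) (just φ) → G4WK ((◇ γ) ∷ ψ ∷ Γ) Δ → G4WK Γ₀ Δ
  ◇L'  : ∀ {Γ₀ Γ φ Δ} → Γ₀ ↭ ((◇ φ) ∷ Γ) →
         G4WK (φ ∷ boxInv Γ) (diaInv Δ) → G4WK Γ₀ Δ

-- Backward proof search terminates.  Weigh a formula of Dyckhoff weight w by 3 ^ w
-- and a sequent by the sum of the weights of its formulas.  Every premise of every
-- rule of G4CK and G4WK is then strictly lighter than the conclusion: the principal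
-- formula is replaced by at most two formulas of smaller Dyckhoff weight (and
-- 3 ^ a + 3 ^ b < 3 ^ c when a, b < c), while □⁻¹ and ◇⁻¹ never add weight.  For a
-- given conclusion there are only finitely many rule instances, one per choice of
-- principal formulas in the antecedent, so derivability reduces to a finite
-- Boolean combination of derivability of lighter sequents.
module Submission where

open import Defs
open import Data.Empty using (⊥)
open import Data.List using (List; []; _∷_; mapMaybe)
open import Data.List.Membership.Propositional using (_∈_)
open import Data.List.Relation.Binary.Permutation.Propositional
open import Data.List.Relation.Binary.Permutation.Propositional.Properties
  using (drop-∷; ∈-resp-↭; mapMaybe-↭)
open import Data.List.Relation.Unary.Any using (here; there; any?)
open import Data.Maybe using (Maybe; just; nothing)
open import Data.Maybe.Properties using (just-injective)
open import Data.Nat using (ℕ; suc; _+_; _^_; _≤_; _<_; z≤n; s≤s)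
open import Data.Nat.Properties
open import Algebra.Properties.CommutativeSemigroup +-commutativeSemigroup
  using (x∙yz≈y∙xz; xy∙z≈xz∙y)
open import Data.Product using (_×_; _,_; ∃; ∃₂)
open import Data.Sum using (_⊎_; inj₁; inj₂)
open import Data.Unit using (⊤; tt)
open import Relation.Nullary using (Dec; yes; no)
open import Relation.Nullary.Decidable using (map′; _×-dec_; _⊎-dec_)
open import Relation.Binary.PropositionalEquality
  using (_≡_; refl; sym; cong; subst; subst₂)
import Relation.Binary.PropositionalEquality as ≡

private
  variable
    X : Set
    x y : X
    xs ys zs : List X

data Select {X : Set} : List X → X → List X → Set where
  here  : Select (x ∷ xs) x xs
  there : Select xs y ys → Select (x ∷ xs) y (x ∷ ys)

Select⇒↭ : Select xs x ys → xs ↭ x ∷ ys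
Select⇒↭ here = refl
Select⇒↭ (there s) = trans (prep _ (Select⇒↭ s)) (swap _ _ refl)

Select-∷⇒↭ : Select xs x ys → y ∷ xs ↭ x ∷ y ∷ ys
Select-∷⇒↭ s = Select⇒↭ (there s)

Select-twice⇒↭ : Select xs x ys → Select ys y zs → xs ↭ y ∷ x ∷ zs
Select-twice⇒↭ s s′ = trans (Select⇒↭ s) (Select-∷⇒↭ s′)

∈⇒Select : x ∈ xs → ∃ (Select xs x)
∈⇒Select (here refl) = _ , here
∈⇒Select (there x∈xs) with ∈⇒Select x∈xs
... | _ , s = _ , there s

Pick : (X → List X → Set) → List X → Set
Pick P xs = ∃₂ λ x ys → Select xs x ys × P x ys

↭-pick : {P : X → List X → Set} →
         xs ↭ x ∷ ys → (∀ {zs} → ys ↭ zs → P x zs) → Pick P xs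
↭-pick xs↭ P-of with ∈⇒Select (∈-resp-↭ (↭-sym xs↭) (here refl))
... | zs , s = _ , zs , s , P-of (drop-∷ (↭-trans (↭-sym xs↭) (Select⇒↭ s)))

pick? : {P : X → List X → Set} (xs : List X) →
        (∀ {x ys} → Select xs x ys → Dec (P x ys)) → Dec (Pick P xs)
pick? [] P? = no λ ()
pick? (x ∷ xs) P? with P? here | pick? xs (λ s → P? (there s))
... | yes p | _ = yes (x , xs , here , p)
... | no _ | yes (y , ys , s , p) = yes (y , x ∷ ys , there s , p)
... | no ¬p | no ¬q = no λ where
  (_ , _ , here , p) → ¬p p
  (_ , _ , there s , p) → ¬q (_ , _ , s , p)

var-≟ : ∀ p A → Dec (var p ≡ A)
var-≟ p (var q) = map′ (cong var) (λ { refl → refl }) (p ≟ q)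
var-≟ p ⊥' = no λ ()
var-≟ p (_ ∧' _) = no λ ()
var-≟ p (_ ∨' _) = no λ ()
var-≟ p (_ ⇒ _) = no λ ()
var-≟ p (□ _) = no λ ()
var-≟ p (◇ _) = no λ ()

OnDiamond : (Fml → List Fml → Set) → Fml → List Fml → Set
OnDiamond P (◇ φ) R = P φ R
OnDiamond P _ R = ⊥

onDiamond? : {P : Fml → List Fml → Set} (A : Fml) (R : List Fml) →
             (∀ φ → A ≡ ◇ φ → Dec (P φ R)) → Dec (OnDiamond P A R)
onDiamond? (◇ φ) R P? = P? φ refl
onDiamond? (var _) R _ = no λ ()
onDiamond? ⊥' R _ = no λ ()
onDiamond? (_ ∧' _) R _ = no λ ()
onDiamond? (_ ∨' _) R _ = no λ ()
onDiamond? (_ ⇒ _) R _ = no λ ()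
onDiamond? (□ _) R _ = no λ ()

unbox : Fml → Maybe Fml
unbox (□ φ) = just φ
unbox _ = nothing

boxInv≡mapMaybe-unbox : ∀ Γ → boxInv Γ ≡ mapMaybe unbox Γ
boxInv≡mapMaybe-unbox [] = refl
boxInv≡mapMaybe-unbox (□ φ ∷ Γ) = cong (φ ∷_) (boxInv≡mapMaybe-unbox Γ)
boxInv≡mapMaybe-unbox (var _ ∷ Γ) = boxInv≡mapMaybe-unbox Γ
boxInv≡mapMaybe-unbox (⊥' ∷ Γ) = boxInv≡mapMaybe-unbox Γ
boxInv≡mapMaybe-unbox ((_ ∧' _) ∷ Γ) = boxInv≡mapMaybe-unbox Γ
boxInv≡mapMaybe-unbox ((_ ∨' _) ∷ Γ) = boxInv≡mapMaybe-unbox Γ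
boxInv≡mapMaybe-unbox ((_ ⇒ _) ∷ Γ) = boxInv≡mapMaybe-unbox Γ
boxInv≡mapMaybe-unbox (◇ _ ∷ Γ) = boxInv≡mapMaybe-unbox Γ

boxInv-↭ : ∀ {Γ Γ′} → Γ ↭ Γ′ → boxInv Γ ↭ boxInv Γ′
boxInv-↭ {Γ} {Γ′} Γ↭Γ′ =
  subst₂ _↭_ (sym (boxInv≡mapMaybe-unbox Γ)) (sym (boxInv≡mapMaybe-unbox Γ′))
    (mapMaybe-↭ unbox Γ↭Γ′)

-- Dyckhoff's weight: ∧ counts twice, so that φ ⇒ (ψ ⇒ χ) is lighter than (φ ∧ ψ) ⇒ χ.
w : Fml → ℕ
w (var _) = 0
w ⊥' = 0
w (φ ∧' ψ) = 2 + w φ + w ψ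
w (φ ∨' ψ) = 1 + w φ + w ψ
w (φ ⇒ ψ) = 1 + w φ + w ψ
w (□ φ) = 1 + w φ
w (◇ φ) = 1 + w φ

-- Opaque, so that unification can recover φ from ‖ φ ‖.
opaque
  ‖_‖ : Fml → ℕ
  ‖ φ ‖ = 3 ^ w φ

‖_‖ᶜ : List Fml → ℕ
‖ [] ‖ᶜ = 0
‖ φ ∷ Γ ‖ᶜ = ‖ φ ‖ + ‖ Γ ‖ᶜ

3^-+-< : ∀ {a b c} → a < c → b < c → 3 ^ a + 3 ^ b < 3 ^ c
3^-+-< {a} {b} {suc k} (s≤s a≤k) (s≤s b≤k) = begin-strict
  3 ^ a + 3 ^ b             ≤⟨ +-mono-≤ (^-monoʳ-≤ 3 a≤k) (^-monoʳ-≤ 3 b≤k) ⟩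
  3 ^ k + 3 ^ k             <⟨ +-monoʳ-< (3 ^ k) (m<m+n (3 ^ k) (m^n>0 3 k)) ⟩
  3 ^ k + (3 ^ k + 3 ^ k)   ≡⟨ cong (λ n → 3 ^ k + (3 ^ k + n)) (sym (+-identityʳ (3 ^ k))) ⟩
  3 ^ suc k                 ∎
  where open ≤-Reasoning

opaque
  unfolding ‖_‖

  ‖‖-< : ∀ {φ ψ} → w φ < w ψ → ‖ φ ‖ < ‖ ψ ‖
  ‖‖-< = ^-monoʳ-< 3 (s≤s (s≤s z≤n))

  ‖‖-+-< : ∀ {φ ψ χ} → w φ < w χ → w ψ < w χ → ‖ φ ‖ + ‖ ψ ‖ < ‖ χ ‖
  ‖‖-+-< = 3^-+-<

module _ (φ ψ : Fml) where

  ‖‖-∧ : ‖ φ ‖ + ‖ ψ ‖ < ‖ φ ∧' ψ ‖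
  ‖‖-∧ = ‖‖-+-< 
    (m<n⇒m<1+n (s≤s (m≤m+n (w φ) (w ψ)))) (m<n⇒m<1+n (s≤s (m≤n+m (w ψ) (w φ))))

  ‖‖-∧ˡ : ‖ φ ‖ < ‖ φ ∧' ψ ‖
  ‖‖-∧ˡ = ≤-<-trans (m≤m+n (‖ φ ‖) (‖ ψ ‖)) ‖‖-∧

  ‖‖-∧ʳ : ‖ ψ ‖ < ‖ φ ∧' ψ ‖
  ‖‖-∧ʳ = ≤-<-trans (m≤n+m (‖ ψ ‖) (‖ φ ‖)) ‖‖-∧

  ‖‖-∨ˡ : ‖ φ ‖ < ‖ φ ∨' ψ ‖
  ‖‖-∨ˡ = ‖‖-< (s≤s (m≤m+n (w φ) (w ψ)))

  ‖‖-∨ʳ : ‖ ψ ‖ < ‖ φ ∨' ψ ‖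
  ‖‖-∨ʳ = ‖‖-< (s≤s (m≤n+m (w ψ) (w φ)))

  ‖‖-⇒ : ‖ φ ‖ + ‖ ψ ‖ < ‖ φ ⇒ ψ ‖
  ‖‖-⇒ = ‖‖-+-< (s≤s (m≤m+n (w φ) (w ψ))) (s≤s (m≤n+m (w ψ) (w φ)))

  ‖‖-⇒ˡ : ‖ φ ‖ < ‖ φ ⇒ ψ ‖
  ‖‖-⇒ˡ = ≤-<-trans (m≤m+n (‖ φ ‖) (‖ ψ ‖)) ‖‖-⇒

  ‖‖-⇒ʳ : ‖ ψ ‖ < ‖ φ ⇒ ψ ‖
  ‖‖-⇒ʳ = ≤-<-trans (m≤n+m (‖ ψ ‖) (‖ φ ‖)) ‖‖-⇒

‖‖-□ : ∀ φ → ‖ φ ‖ < ‖ □ φ ‖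
‖‖-□ φ = ‖‖-< ≤-refl

‖‖-◇ : ∀ φ → ‖ φ ‖ < ‖ ◇ φ ‖
‖‖-◇ φ = ‖‖-< ≤-refl

module _ (φ ψ χ : Fml) where

  ‖‖-∧⇒ : ‖ φ ⇒ (ψ ⇒ χ) ‖ < ‖ (φ ∧' ψ) ⇒ χ ‖
  ‖‖-∧⇒ = ‖‖-< (s≤s (s≤s (≤-reflexive
    (≡.trans (+-suc (w φ) (w ψ + w χ)) (cong suc (sym (+-assoc (w φ) (w ψ) (w χ))))))))

  ‖‖-∨⇒ : ‖ φ ⇒ χ ‖ + ‖ ψ ⇒ χ ‖ < ‖ (φ ∨' ψ) ⇒ χ ‖
  ‖‖-∨⇒ = ‖‖-+-< 
    (s≤s (s≤s (+-monoˡ-≤ (w χ) (m≤m+n (w φ) (w ψ)))))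
    (s≤s (s≤s (+-monoˡ-≤ (w χ) (m≤n+m (w ψ) (w φ)))))

  ‖‖-⇒⇒ : ‖ ψ ⇒ χ ‖ + ‖ φ ⇒ ψ ‖ < ‖ (φ ⇒ ψ) ⇒ χ ‖
  ‖‖-⇒⇒ = ‖‖-+-< 
    (s≤s (s≤s (+-monoˡ-≤ (w χ) (m≤n+m (w ψ) (w φ)))))
    (s≤s (s≤s (m≤m+n (w φ + w ψ) (w χ))))

‖‖ᶜ-Select : ∀ {Γ A R} → Select Γ A R → ‖ Γ ‖ᶜ ≡ ‖ A ∷ R ‖ᶜ
‖‖ᶜ-Select here = refl
‖‖ᶜ-Select {x ∷ _} {A} {_ ∷ R} (there s) =
  ≡.trans (cong (‖ x ‖ +_) (‖‖ᶜ-Select s)) (x∙yz≈y∙xz (‖ x ‖) (‖ A ‖) (‖ R ‖ᶜ))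

‖boxInv‖ᶜ≤ : ∀ Γ → ‖ boxInv Γ ‖ᶜ ≤ ‖ Γ ‖ᶜ
‖boxInv‖ᶜ≤ [] = ≤-refl
‖boxInv‖ᶜ≤ (□ φ ∷ Γ) = +-mono-≤ (<⇒≤ (‖‖-□ φ)) (‖boxInv‖ᶜ≤ Γ)
‖boxInv‖ᶜ≤ (var p ∷ Γ) = ≤-trans (‖boxInv‖ᶜ≤ Γ) (m≤n+m _ _)
‖boxInv‖ᶜ≤ (⊥' ∷ Γ) = ≤-trans (‖boxInv‖ᶜ≤ Γ) (m≤n+m _ _)
‖boxInv‖ᶜ≤ ((φ ∧' ψ) ∷ Γ) = ≤-trans (‖boxInv‖ᶜ≤ Γ) (m≤n+m _ _)
‖boxInv‖ᶜ≤ ((φ ∨' ψ) ∷ Γ) = ≤-trans (‖boxInv‖ᶜ≤ Γ) (m≤n+m _ _)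
‖boxInv‖ᶜ≤ ((φ ⇒ ψ) ∷ Γ) = ≤-trans (‖boxInv‖ᶜ≤ Γ) (m≤n+m _ _)
‖boxInv‖ᶜ≤ (◇ φ ∷ Γ) = ≤-trans (‖boxInv‖ᶜ≤ Γ) (m≤n+m _ _)

-- The sequent Γ ⇒ Δ weighs ‖ Γ ‖ᶜ + ‖ Δ ‖; d is the weight of the conclusion's succedent.
module _ {A : Fml} {R : List Fml} (d : ℕ) where
  open ≤-Reasoning

  ∷-lighter : ∀ {X} → ‖ X ‖ < ‖ A ‖ → ‖ X ∷ R ‖ᶜ + d < ‖ A ∷ R ‖ᶜ + d
  ∷-lighter X<A = +-monoˡ-< d (+-monoˡ-< (‖ R ‖ᶜ) X<A)

  ∷∷-lighter : ∀ {X Y} → ‖ X ‖ + ‖ Y ‖ < ‖ A ‖ → ‖ X ∷ Y ∷ R ‖ᶜ + d < ‖ A ∷ R ‖ᶜ + d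
  ∷∷-lighter {X} {Y} XY<A = +-monoˡ-< d (begin-strict
    ‖ X ‖ + (‖ Y ‖ + ‖ R ‖ᶜ)   ≡⟨ sym (+-assoc (‖ X ‖) (‖ Y ‖) (‖ R ‖ᶜ)) ⟩
    ‖ X ‖ + ‖ Y ‖ + ‖ R ‖ᶜ     <⟨ +-monoˡ-< (‖ R ‖ᶜ) XY<A ⟩
    ‖ A ‖ + ‖ R ‖ᶜ             ∎)

  ∷-succedent-lighter : ∀ {X Y} → ‖ X ‖ + ‖ Y ‖ < ‖ A ‖ →
                        ‖ X ∷ R ‖ᶜ + ‖ Y ‖ < ‖ A ∷ R ‖ᶜ + d
  ∷-succedent-lighter {X} {Y} XY<A = begin-strict
    ‖ X ‖ + ‖ R ‖ᶜ + ‖ Y ‖     ≡⟨ xy∙z≈xz∙y (‖ X ‖) (‖ R ‖ᶜ) (‖ Y ‖) ⟩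
    ‖ X ‖ + ‖ Y ‖ + ‖ R ‖ᶜ     <⟨ +-monoˡ-< (‖ R ‖ᶜ) XY<A ⟩
    ‖ A ‖ + ‖ R ‖ᶜ             ≤⟨ m≤m+n _ d ⟩
    ‖ A ‖ + ‖ R ‖ᶜ + d         ∎

  succedent-lighter : ∀ {Γ Y} → ‖ Y ‖ < ‖ A ‖ → ‖ Γ ‖ᶜ ≤ ‖ R ‖ᶜ →
                      ‖ Γ ‖ᶜ + ‖ Y ‖ < ‖ A ∷ R ‖ᶜ + d
  succedent-lighter {Γ} {Y} Y<A Γ≤R = begin-strict
    ‖ Γ ‖ᶜ + ‖ Y ‖             ≡⟨ +-comm (‖ Γ ‖ᶜ) (‖ Y ‖) ⟩
    ‖ Y ‖ + ‖ Γ ‖ᶜ             <⟨ +-mono-<-≤ Y<A Γ≤R ⟩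
    ‖ A ‖ + ‖ R ‖ᶜ             ≤⟨ m≤m+n _ d ⟩
    ‖ A ‖ + ‖ R ‖ᶜ + d         ∎

⇒R-lighter : ∀ {Γ φ ψ} → ‖ φ ∷ Γ ‖ᶜ + ‖ ψ ‖ < ‖ Γ ‖ᶜ + ‖ φ ⇒ ψ ‖
⇒R-lighter {Γ} {φ} {ψ} = begin-strict
  ‖ φ ‖ + ‖ Γ ‖ᶜ + ‖ ψ ‖       ≡⟨ ≡.trans (+-assoc (‖ φ ‖) (‖ Γ ‖ᶜ) (‖ ψ ‖)) (x∙yz≈y∙xz (‖ φ ‖) (‖ Γ ‖ᶜ) (‖ ψ ‖)) ⟩
  ‖ Γ ‖ᶜ + (‖ φ ‖ + ‖ ψ ‖)     <⟨ +-monoʳ-< (‖ Γ ‖ᶜ) (‖‖-⇒ φ ψ) ⟩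
  ‖ Γ ‖ᶜ + ‖ φ ⇒ ψ ‖           ∎
  where open ≤-Reasoning

□R-lighter : ∀ {Γ φ} → ‖ boxInv Γ ‖ᶜ + ‖ φ ‖ < ‖ Γ ‖ᶜ + ‖ □ φ ‖
□R-lighter {Γ} {φ} = +-mono-≤-< (‖boxInv‖ᶜ≤ Γ) (‖‖-□ φ)

◇∷-lighter : ∀ γ R → ‖ γ ∷ boxInv R ‖ᶜ < ‖ ◇ γ ∷ R ‖ᶜ
◇∷-lighter γ R = +-mono-<-≤ (‖‖-◇ γ) (‖boxInv‖ᶜ≤ R)

◇L-lighter : ∀ {Γ φ R e d} → Select Γ (◇ φ) R → e ≤ d →
             ‖ φ ∷ boxInv R ‖ᶜ + e < ‖ Γ ‖ᶜ + d
◇L-lighter {φ = φ} {R} {d = d} s e≤d = <-≤-trans (+-mono-<-≤ (◇∷-lighter φ R) e≤d)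
  (≤-reflexive (cong (_+ d) (sym (‖‖ᶜ-Select s))))

module _ {S : Set} (D : List Fml → S → Set) (‖_‖ˢ : S → ℕ) where

  Below : ℕ → Set
  Below n = ∀ Γ Δ → ‖ Γ ‖ᶜ + ‖ Δ ‖ˢ < n → Dec (D Γ Δ)

  decidable-by-weight : (∀ Γ Δ → Below (‖ Γ ‖ᶜ + ‖ Δ ‖ˢ) → Dec (D Γ Δ)) →
                        ∀ Γ Δ → Dec (D Γ Δ)
  decidable-by-weight step Γ Δ = below (suc (‖ Γ ‖ᶜ + ‖ Δ ‖ˢ)) Γ Δ ≤-refl
    where
    below : ∀ n → Below n
    below (suc n) Γ Δ (s≤s ≤n) = step Γ Δ λ Γ′ Δ′ lt → below n Γ′ Δ′ (<-≤-trans lt ≤n)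

-- ⌜ φ ⌝ is the succedent consisting of the formula φ.
module CommonLeftRules
  {S : Set} (D : List Fml → S → Set) (‖_‖ˢ : S → ℕ)
  (⌜_⌝ : Fml → S) (‖⌜_⌝‖ : ∀ φ → ‖ ⌜ φ ⌝ ‖ˢ ≡ ‖ φ ‖)
  (⌜var⌝-≟ : ∀ p Δ → Dec (⌜ var p ⌝ ≡ Δ))
  (exchange : ∀ {Γ Γ′ Δ} → Γ ↭ Γ′ → D Γ Δ → D Γ′ Δ)
  (⊥L  : ∀ {Γ₀ Γ Δ} → Γ₀ ↭ ⊥' ∷ Γ → D Γ₀ Δ)
  (IdP : ∀ {Γ₀ Γ p} → Γ₀ ↭ var p ∷ Γ → D Γ₀ ⌜ var p ⌝)
  (∧L  : ∀ {Γ₀ Γ φ ψ Δ} → Γ₀ ↭ (φ ∧' ψ) ∷ Γ → D (φ ∷ ψ ∷ Γ) Δ → D Γ₀ Δ)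
  (∨L  : ∀ {Γ₀ Γ φ ψ Δ} → Γ₀ ↭ (φ ∨' ψ) ∷ Γ →
         D (φ ∷ Γ) Δ → D (ψ ∷ Γ) Δ → D Γ₀ Δ)
  (∧⇒L : ∀ {Γ₀ Γ φ ψ χ Δ} → Γ₀ ↭ ((φ ∧' ψ) ⇒ χ) ∷ Γ →
         D ((φ ⇒ (ψ ⇒ χ)) ∷ Γ) Δ → D Γ₀ Δ)
  (∨⇒L : ∀ {Γ₀ Γ φ ψ χ Δ} → Γ₀ ↭ ((φ ∨' ψ) ⇒ χ) ∷ Γ →
         D ((φ ⇒ χ) ∷ (ψ ⇒ χ) ∷ Γ) Δ → D Γ₀ Δ)
  (p⇒L : ∀ {Γ₀ Γ p φ Δ} → Γ₀ ↭ var p ∷ (var p ⇒ φ) ∷ Γ →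
         D (var p ∷ φ ∷ Γ) Δ → D Γ₀ Δ)
  (⇒⇒L : ∀ {Γ₀ Γ φ ψ χ Δ} → Γ₀ ↭ ((φ ⇒ ψ) ⇒ χ) ∷ Γ →
         D ((ψ ⇒ χ) ∷ Γ) ⌜ φ ⇒ ψ ⌝ → D (χ ∷ Γ) Δ → D Γ₀ Δ)
  (□⇒L : ∀ {Γ₀ Γ φ ψ Δ} → Γ₀ ↭ (□ φ ⇒ ψ) ∷ Γ →
         D (boxInv Γ) ⌜ φ ⌝ → D (ψ ∷ Γ) Δ → D Γ₀ Δ)
  (◇⇒L : ∀ {Γ₀ Γ γ φ ψ Δ} → Γ₀ ↭ ◇ γ ∷ (◇ φ ⇒ ψ) ∷ Γ →
         D (γ ∷ boxInv Γ) ⌜ φ ⌝ → D (◇ γ ∷ ψ ∷ Γ) Δ → D Γ₀ Δ)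
  where

  ◇⇒L-premise : Fml → Fml → List Fml → Set
  ◇⇒L-premise φ = OnDiamond λ γ R → D (γ ∷ boxInv R) ⌜ φ ⌝

  -- Left Δ A R: a rule with principal formula A applies to A ∷ R ⇒ Δ and its
  -- premises are derivable.
  Left : S → Fml → List Fml → Set
  Left Δ ⊥' R = ⊤
  Left Δ (var p) R = ⌜ var p ⌝ ≡ Δ
  Left Δ (φ ∧' ψ) R = D (φ ∷ ψ ∷ R) Δ
  Left Δ (φ ∨' ψ) R = D (φ ∷ R) Δ × D (ψ ∷ R) Δ
  Left Δ (var p ⇒ φ) R = var p ∈ R × D (φ ∷ R) Δ
  Left Δ ((φ ∧' ψ) ⇒ χ) R = D ((φ ⇒ (ψ ⇒ χ)) ∷ R) Δ
  Left Δ ((φ ∨' ψ) ⇒ χ) R = D ((φ ⇒ χ) ∷ (ψ ⇒ χ) ∷ R) Δ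
  Left Δ ((φ ⇒ ψ) ⇒ χ) R = D ((ψ ⇒ χ) ∷ R) ⌜ φ ⇒ ψ ⌝ × D (χ ∷ R) Δ
  Left Δ (□ φ ⇒ ψ) R = D (boxInv R) ⌜ φ ⌝ × D (ψ ∷ R) Δ
  Left Δ (◇ φ ⇒ ψ) R = Pick (◇⇒L-premise φ) R × D (ψ ∷ R) Δ
  Left Δ _ R = ⊥

  left-sound : ∀ {Γ Δ} A {R} → Select Γ A R → Left Δ A R → D Γ Δ
  left-sound ⊥' s _ = ⊥L (Select⇒↭ s)
  left-sound (var p) s refl = IdP (Select⇒↭ s)
  left-sound (φ ∧' ψ) s d = ∧L (Select⇒↭ s) d
  left-sound (φ ∨' ψ) s (d , e) = ∨L (Select⇒↭ s) d e
  left-sound (var p ⇒ φ) s (p∈R , d) with ∈⇒Select p∈R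
  ... | _ , s′ = p⇒L (Select-twice⇒↭ s s′) (exchange (Select-∷⇒↭ s′) d)
  left-sound ((φ ∧' ψ) ⇒ χ) s d = ∧⇒L (Select⇒↭ s) d
  left-sound ((φ ∨' ψ) ⇒ χ) s d = ∨⇒L (Select⇒↭ s) d
  left-sound ((φ ⇒ ψ) ⇒ χ) s (d , e) = ⇒⇒L (Select⇒↭ s) d e
  left-sound (□ φ ⇒ ψ) s (d , e) = □⇒L (Select⇒↭ s) d e
  left-sound (◇ φ ⇒ ψ) s ((◇ γ , _ , s′ , d) , e) =
    ◇⇒L (Select-twice⇒↭ s s′) d (exchange (Select-∷⇒↭ s′) e)

  lefts-sound : ∀ {Γ Δ} → Pick (Left Δ) Γ → D Γ Δ
  lefts-sound (A , _ , s , l) = left-sound A s l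

  IdP-left : ∀ {Γ₀ Γ p} → Γ₀ ↭ var p ∷ Γ → Pick (Left ⌜ var p ⌝) Γ₀
  IdP-left p = ↭-pick p λ _ → refl

  module _ {Γ₀ Γ : List Fml} {Δ : S} where

    ⊥L-left : Γ₀ ↭ ⊥' ∷ Γ → Pick (Left Δ) Γ₀
    ⊥L-left p = ↭-pick p λ _ → tt

    ∧L-left : ∀ {φ ψ} → Γ₀ ↭ (φ ∧' ψ) ∷ Γ → D (φ ∷ ψ ∷ Γ) Δ → Pick (Left Δ) Γ₀
    ∧L-left p d = ↭-pick p λ q → exchange (prep _ (prep _ q)) d

    ∨L-left : ∀ {φ ψ} → Γ₀ ↭ (φ ∨' ψ) ∷ Γ →
              D (φ ∷ Γ) Δ → D (ψ ∷ Γ) Δ → Pick (Left Δ) Γ₀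
    ∨L-left p d e = ↭-pick p λ q → exchange (prep _ q) d , exchange (prep _ q) e

    ∧⇒L-left : ∀ {φ ψ χ} → Γ₀ ↭ ((φ ∧' ψ) ⇒ χ) ∷ Γ →
               D ((φ ⇒ (ψ ⇒ χ)) ∷ Γ) Δ → Pick (Left Δ) Γ₀
    ∧⇒L-left p d = ↭-pick p λ q → exchange (prep _ q) d

    ∨⇒L-left : ∀ {φ ψ χ} → Γ₀ ↭ ((φ ∨' ψ) ⇒ χ) ∷ Γ →
               D ((φ ⇒ χ) ∷ (ψ ⇒ χ) ∷ Γ) Δ → Pick (Left Δ) Γ₀
    ∨⇒L-left p d = ↭-pick p λ q → exchange (prep _ (prep _ q)) d

    p⇒L-left : ∀ {p φ} → Γ₀ ↭ var p ∷ (var p ⇒ φ) ∷ Γ →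
               D (var p ∷ φ ∷ Γ) Δ → Pick (Left Δ) Γ₀
    p⇒L-left p d = ↭-pick (trans p (swap _ _ refl)) λ q →
      ∈-resp-↭ q (here refl) , exchange (trans (swap _ _ refl) (prep _ q)) d

    ⇒⇒L-left : ∀ {φ ψ χ} → Γ₀ ↭ ((φ ⇒ ψ) ⇒ χ) ∷ Γ →
               D ((ψ ⇒ χ) ∷ Γ) ⌜ φ ⇒ ψ ⌝ → D (χ ∷ Γ) Δ → Pick (Left Δ) Γ₀
    ⇒⇒L-left p d e = ↭-pick p λ q → exchange (prep _ q) d , exchange (prep _ q) e

    □⇒L-left : ∀ {φ ψ} → Γ₀ ↭ (□ φ ⇒ ψ) ∷ Γ →
               D (boxInv Γ) ⌜ φ ⌝ → D (ψ ∷ Γ) Δ → Pick (Left Δ) Γ₀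
    □⇒L-left p d e = ↭-pick p λ q → exchange (boxInv-↭ q) d , exchange (prep _ q) e

    ◇⇒L-left : ∀ {γ φ ψ} → Γ₀ ↭ ◇ γ ∷ (◇ φ ⇒ ψ) ∷ Γ →
               D (γ ∷ boxInv Γ) ⌜ φ ⌝ → D (◇ γ ∷ ψ ∷ Γ) Δ → Pick (Left Δ) Γ₀
    ◇⇒L-left p d e = ↭-pick (trans p (swap _ _ refl)) λ q →
      ↭-pick (↭-sym q) (λ q′ → exchange (prep _ (boxInv-↭ q′)) d) ,
      exchange (trans (swap _ _ refl) (prep _ q)) e

  module _ {Δ : S} {A : Fml} {R : List Fml}
           (below : Below D ‖_‖ˢ (‖ A ∷ R ‖ᶜ + ‖ Δ ‖ˢ)) where

    below-∷ : ∀ {X} → ‖ X ‖ < ‖ A ‖ → Dec (D (X ∷ R) Δ)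
    below-∷ X<A = below _ Δ (∷-lighter {R = R} ‖ Δ ‖ˢ X<A)

    below-∷∷ : ∀ {X Y} → ‖ X ‖ + ‖ Y ‖ < ‖ A ‖ → Dec (D (X ∷ Y ∷ R) Δ)
    below-∷∷ XY<A = below _ Δ (∷∷-lighter {R = R} ‖ Δ ‖ˢ XY<A)

    below-∷-⌜⌝ : ∀ {X} Y → ‖ X ‖ + ‖ Y ‖ < ‖ A ‖ → Dec (D (X ∷ R) ⌜ Y ⌝)
    below-∷-⌜⌝ {X} Y XY<A = below _ ⌜ Y ⌝
      (subst (λ n → ‖ X ∷ R ‖ᶜ + n < ‖ A ∷ R ‖ᶜ + ‖ Δ ‖ˢ) (sym ‖⌜ Y ⌝‖)
        (∷-succedent-lighter {R = R} ‖ Δ ‖ˢ XY<A))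

    below-⌜⌝ : ∀ Γ Y → ‖ Y ‖ < ‖ A ‖ → ‖ Γ ‖ᶜ ≤ ‖ R ‖ᶜ → Dec (D Γ ⌜ Y ⌝)
    below-⌜⌝ Γ Y Y<A Γ≤R = below Γ ⌜ Y ⌝
      (subst (λ n → ‖ Γ ‖ᶜ + n < ‖ A ∷ R ‖ᶜ + ‖ Δ ‖ˢ) (sym ‖⌜ Y ⌝‖)
        (succedent-lighter {R = R} ‖ Δ ‖ˢ {Γ} Y<A Γ≤R))

  left? : ∀ Δ A R → Below D ‖_‖ˢ (‖ A ∷ R ‖ᶜ + ‖ Δ ‖ˢ) → Dec (Left Δ A R)
  left? Δ ⊥' R _ = yes tt
  left? Δ (var p) R _ = ⌜var⌝-≟ p Δ
  left? Δ (φ ∧' ψ) R below = below-∷∷ below (‖‖-∧ φ ψ)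
  left? Δ (φ ∨' ψ) R below = below-∷ below (‖‖-∨ˡ φ ψ) ×-dec below-∷ below (‖‖-∨ʳ φ ψ)
  left? Δ (var p ⇒ φ) R below = any? (var-≟ p) R ×-dec below-∷ below (‖‖-⇒ʳ (var p) φ)
  left? Δ ((φ ∧' ψ) ⇒ χ) R below = below-∷ below (‖‖-∧⇒ φ ψ χ)
  left? Δ ((φ ∨' ψ) ⇒ χ) R below = below-∷∷ below (‖‖-∨⇒ φ ψ χ)
  left? Δ ((φ ⇒ ψ) ⇒ χ) R below =
    below-∷-⌜⌝ below (φ ⇒ ψ) (‖‖-⇒⇒ φ ψ χ) ×-dec below-∷ below (‖‖-⇒ʳ (φ ⇒ ψ) χ)
  left? Δ (□ φ ⇒ ψ) R below =
    below-⌜⌝ {R = R} below (boxInv R) φ (<-trans (‖‖-□ φ) (‖‖-⇒ˡ (□ φ) ψ)) (‖boxInv‖ᶜ≤ R) ×-dec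
    below-∷ below (‖‖-⇒ʳ (□ φ) ψ)
  left? Δ (◇ φ ⇒ ψ) R below = pick? R premise? ×-dec below-∷ below (‖‖-⇒ʳ (◇ φ) ψ)
    where
    premise? : ∀ {B R′} → Select R B R′ → Dec (◇⇒L-premise φ B R′)
    premise? {B} {R′} s = onDiamond? B R′ λ where
      γ refl → below-⌜⌝ {R = R} below (γ ∷ boxInv R′) φ (<-trans (‖‖-◇ φ) (‖‖-⇒ˡ (◇ φ) ψ))
        (≤-trans (<⇒≤ (◇∷-lighter γ R′)) (≤-reflexive (sym (‖‖ᶜ-Select s))))
  left? Δ (⊥' ⇒ _) R _ = no λ ()
  left? Δ (□ _) R _ = no λ ()
  left? Δ (◇ _) R _ = no λ ()

  lefts? : ∀ Γ Δ → Below D ‖_‖ˢ (‖ Γ ‖ᶜ + ‖ Δ ‖ˢ) → Dec (Pick (Left Δ) Γ)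
  lefts? Γ Δ below = pick? Γ λ {A} {R} s →
    left? Δ A R (subst (λ n → Below D ‖_‖ˢ (n + ‖ Δ ‖ˢ)) (‖‖ᶜ-Select s) below)

module CK where

  exchange : ∀ {Γ Γ′ Δ} → Γ ↭ Γ′ → G4CK Γ Δ → G4CK Γ′ Δ
  exchange q (⊥L p) = ⊥L (↭-trans (↭-sym q) p)
  exchange q (IdP p) = IdP (↭-trans (↭-sym q) p)
  exchange q (∧L p d) = ∧L (↭-trans (↭-sym q) p) d
  exchange q (∧R d e) = ∧R (exchange q d) (exchange q e)
  exchange q (∨L p d e) = ∨L (↭-trans (↭-sym q) p) d e
  exchange q (∨R₁ d) = ∨R₁ (exchange q d)
  exchange q (∨R₂ d) = ∨R₂ (exchange q d)
  exchange q (⇒R d) = ⇒R (exchange (prep _ q) d)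
  exchange q (∧⇒L p d) = ∧⇒L (↭-trans (↭-sym q) p) d
  exchange q (∨⇒L p d) = ∨⇒L (↭-trans (↭-sym q) p) d
  exchange q (p⇒L p d) = p⇒L (↭-trans (↭-sym q) p) d
  exchange q (⇒⇒L p d e) = ⇒⇒L (↭-trans (↭-sym q) p) d e
  exchange q (□R d) = □R (exchange (boxInv-↭ q) d)
  exchange q (□⇒L p d e) = □⇒L (↭-trans (↭-sym q) p) d e
  exchange q (◇⇒L p d e) = ◇⇒L (↭-trans (↭-sym q) p) d e
  exchange q (◇L p d) = ◇L (↭-trans (↭-sym q) p) d

  open CommonLeftRules G4CK ‖_‖ (λ φ → φ) (λ _ → refl) var-≟ exchange
    ⊥L IdP ∧L ∨L ∧⇒L ∨⇒L p⇒L ⇒⇒L □⇒L ◇⇒L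

  ◇L-premise : Fml → Fml → List Fml → Set
  ◇L-premise ψ = OnDiamond λ φ R → G4CK (φ ∷ boxInv R) ψ

  -- In G4CK a succedent ◇ ψ can only be introduced by ◇L, which is therefore
  -- grouped with the right rules.
  Right : List Fml → Fml → Set
  Right Γ (φ ∧' ψ) = G4CK Γ φ × G4CK Γ ψ
  Right Γ (φ ∨' ψ) = G4CK Γ φ ⊎ G4CK Γ ψ
  Right Γ (φ ⇒ ψ) = G4CK (φ ∷ Γ) ψ
  Right Γ (□ φ) = G4CK (boxInv Γ) φ
  Right Γ (◇ ψ) = Pick (◇L-premise ψ) Γ
  Right Γ _ = ⊥

  LastRule : List Fml → Fml → Set
  LastRule Γ Δ = Right Γ Δ ⊎ Pick (Left Δ) Γ

  last-rule : ∀ {Γ Δ} → G4CK Γ Δ → LastRule Γ Δ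
  last-rule (⊥L p) = inj₂ (⊥L-left p)
  last-rule (IdP p) = inj₂ (IdP-left p)
  last-rule (∧L p d) = inj₂ (∧L-left p d)
  last-rule (∨L p d e) = inj₂ (∨L-left p d e)
  last-rule (∧⇒L p d) = inj₂ (∧⇒L-left p d)
  last-rule (∨⇒L p d) = inj₂ (∨⇒L-left p d)
  last-rule (p⇒L p d) = inj₂ (p⇒L-left p d)
  last-rule (⇒⇒L p d e) = inj₂ (⇒⇒L-left p d e)
  last-rule (□⇒L p d e) = inj₂ (□⇒L-left p d e)
  last-rule (◇⇒L p d e) = inj₂ (◇⇒L-left p d e)
  last-rule (∧R d e) = inj₁ (d , e)
  last-rule (∨R₁ d) = inj₁ (inj₁ d)
  last-rule (∨R₂ d) = inj₁ (inj₂ d)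
  last-rule (⇒R d) = inj₁ d
  last-rule (□R d) = inj₁ d
  last-rule (◇L p d) = inj₁ (↭-pick p λ q → exchange (prep _ (boxInv-↭ q)) d)

  right-sound : ∀ {Γ} Δ → Right Γ Δ → G4CK Γ Δ
  right-sound (φ ∧' ψ) (d , e) = ∧R d e
  right-sound (φ ∨' ψ) (inj₁ d) = ∨R₁ d
  right-sound (φ ∨' ψ) (inj₂ e) = ∨R₂ e
  right-sound (φ ⇒ ψ) d = ⇒R d
  right-sound (□ φ) d = □R d
  right-sound (◇ ψ) (◇ φ , _ , s , d) = ◇L (Select⇒↭ s) d

  last-rule-sound : ∀ {Γ Δ} → LastRule Γ Δ → G4CK Γ Δ
  last-rule-sound {Δ = Δ} (inj₁ r) = right-sound Δ r
  last-rule-sound (inj₂ l) = lefts-sound l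

  right? : ∀ Γ Δ → Below G4CK ‖_‖ (‖ Γ ‖ᶜ + ‖ Δ ‖) → Dec (Right Γ Δ)
  right? Γ (φ ∧' ψ) below =
    below Γ φ (+-monoʳ-< _ (‖‖-∧ˡ φ ψ)) ×-dec below Γ ψ (+-monoʳ-< _ (‖‖-∧ʳ φ ψ))
  right? Γ (φ ∨' ψ) below =
    below Γ φ (+-monoʳ-< _ (‖‖-∨ˡ φ ψ)) ⊎-dec below Γ ψ (+-monoʳ-< _ (‖‖-∨ʳ φ ψ))
  right? Γ (φ ⇒ ψ) below = below (φ ∷ Γ) ψ (⇒R-lighter {Γ})
  right? Γ (□ φ) below = below (boxInv Γ) φ (□R-lighter {Γ})
  right? Γ (◇ ψ) below = pick? Γ premise?
    where
    premise? : ∀ {B R} → Select Γ B R → Dec (◇L-premise ψ B R)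
    premise? {B} {R} s = onDiamond? B R λ where
      φ refl → below (φ ∷ boxInv R) ψ (◇L-lighter s (<⇒≤ (‖‖-◇ ψ)))
  right? Γ (var _) _ = no λ ()
  right? Γ ⊥' _ = no λ ()

  G4CK? : ∀ Γ Δ → Dec (G4CK Γ Δ)
  G4CK? = decidable-by-weight G4CK ‖_‖ λ Γ Δ below →
    map′ last-rule-sound last-rule (right? Γ Δ below ⊎-dec lefts? Γ Δ below)

module WK where

  ‖_‖ᵐ : Maybe Fml → ℕ
  ‖ nothing ‖ᵐ = 0
  ‖ just φ ‖ᵐ = ‖ φ ‖

  ‖diaInv‖ᵐ≤ : ∀ Δ → ‖ diaInv Δ ‖ᵐ ≤ ‖ Δ ‖ᵐ
  ‖diaInv‖ᵐ≤ (just (◇ φ)) = <⇒≤ (‖‖-◇ φ)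
  ‖diaInv‖ᵐ≤ nothing = ≤-refl
  ‖diaInv‖ᵐ≤ (just (var _)) = z≤n
  ‖diaInv‖ᵐ≤ (just ⊥') = z≤n
  ‖diaInv‖ᵐ≤ (just (_ ∧' _)) = z≤n
  ‖diaInv‖ᵐ≤ (just (_ ∨' _)) = z≤n
  ‖diaInv‖ᵐ≤ (just (_ ⇒ _)) = z≤n
  ‖diaInv‖ᵐ≤ (just (□ _)) = z≤n

  just-var-≟ : ∀ p Δ → Dec (just (var p) ≡ Δ)
  just-var-≟ p nothing = no λ ()
  just-var-≟ p (just A) = map′ (cong just) just-injective (var-≟ p A)

  exchange : ∀ {Γ Γ′ Δ} → Γ ↭ Γ′ → G4WK Γ Δ → G4WK Γ′ Δ
  exchange q (⊥L p) = ⊥L (↭-trans (↭-sym q) p)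
  exchange q (IdP p) = IdP (↭-trans (↭-sym q) p)
  exchange q (∧L p d) = ∧L (↭-trans (↭-sym q) p) d
  exchange q (∧R d e) = ∧R (exchange q d) (exchange q e)
  exchange q (∨L p d e) = ∨L (↭-trans (↭-sym q) p) d e
  exchange q (∨R₁ d) = ∨R₁ (exchange q d)
  exchange q (∨R₂ d) = ∨R₂ (exchange q d)
  exchange q (⇒R d) = ⇒R (exchange (prep _ q) d)
  exchange q (∧⇒L p d) = ∧⇒L (↭-trans (↭-sym q) p) d
  exchange q (∨⇒L p d) = ∨⇒L (↭-trans (↭-sym q) p) d
  exchange q (p⇒L p d) = p⇒L (↭-trans (↭-sym q) p) d
  exchange q (⇒⇒L p d e) = ⇒⇒L (↭-trans (↭-sym q) p) d e
  exchange q (□R d) = □R (exchange (boxInv-↭ q) d)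
  exchange q (□⇒L p d e) = □⇒L (↭-trans (↭-sym q) p) d e
  exchange q (◇⇒L p d e) = ◇⇒L (↭-trans (↭-sym q) p) d e
  exchange q (◇L' p d) = ◇L' (↭-trans (↭-sym q) p) d

  open CommonLeftRules G4WK ‖_‖ᵐ just (λ _ → refl) just-var-≟ exchange
    ⊥L IdP ∧L ∨L ∧⇒L ∨⇒L p⇒L ⇒⇒L □⇒L ◇⇒L

  ◇L′-premise : Maybe Fml → Fml → List Fml → Set
  ◇L′-premise Δ = OnDiamond λ φ R → G4WK (φ ∷ boxInv R) (diaInv Δ)

  Right : List Fml → Maybe Fml → Set
  Right Γ (just (φ ∧' ψ)) = G4WK Γ (just φ) × G4WK Γ (just ψ)
  Right Γ (just (φ ∨' ψ)) = G4WK Γ (just φ) ⊎ G4WK Γ (just ψ)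
  Right Γ (just (φ ⇒ ψ)) = G4WK (φ ∷ Γ) (just ψ)
  Right Γ (just (□ φ)) = G4WK (boxInv Γ) (just φ)
  Right Γ _ = ⊥

  LastRule : List Fml → Maybe Fml → Set
  LastRule Γ Δ = Right Γ Δ ⊎ Pick (Left Δ) Γ ⊎ Pick (◇L′-premise Δ) Γ

  last-rule : ∀ {Γ Δ} → G4WK Γ Δ → LastRule Γ Δ
  last-rule (⊥L p) = inj₂ (inj₁ (⊥L-left p))
  last-rule (IdP p) = inj₂ (inj₁ (IdP-left p))
  last-rule (∧L p d) = inj₂ (inj₁ (∧L-left p d))
  last-rule (∨L p d e) = inj₂ (inj₁ (∨L-left p d e))
  last-rule (∧⇒L p d) = inj₂ (inj₁ (∧⇒L-left p d))
  last-rule (∨⇒L p d) = inj₂ (inj₁ (∨⇒L-left p d))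
  last-rule (p⇒L p d) = inj₂ (inj₁ (p⇒L-left p d))
  last-rule (⇒⇒L p d e) = inj₂ (inj₁ (⇒⇒L-left p d e))
  last-rule (□⇒L p d e) = inj₂ (inj₁ (□⇒L-left p d e))
  last-rule (◇⇒L p d e) = inj₂ (inj₁ (◇⇒L-left p d e))
  last-rule (∧R d e) = inj₁ (d , e)
  last-rule (∨R₁ d) = inj₁ (inj₁ d)
  last-rule (∨R₂ d) = inj₁ (inj₂ d)
  last-rule (⇒R d) = inj₁ d
  last-rule (□R d) = inj₁ d
  last-rule (◇L' p d) = inj₂ (inj₂ (↭-pick p λ q → exchange (prep _ (boxInv-↭ q)) d))

  right-sound : ∀ {Γ} Δ → Right Γ Δ → G4WK Γ Δ
  right-sound (just (φ ∧' ψ)) (d , e) = ∧R d e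
  right-sound (just (φ ∨' ψ)) (inj₁ d) = ∨R₁ d
  right-sound (just (φ ∨' ψ)) (inj₂ e) = ∨R₂ e
  right-sound (just (φ ⇒ ψ)) d = ⇒R d
  right-sound (just (□ φ)) d = □R d

  last-rule-sound : ∀ {Γ Δ} → LastRule Γ Δ → G4WK Γ Δ
  last-rule-sound {Δ = Δ} (inj₁ r) = right-sound Δ r
  last-rule-sound (inj₂ (inj₁ l)) = lefts-sound l
  last-rule-sound (inj₂ (inj₂ (◇ φ , _ , s , d))) = ◇L' (Select⇒↭ s) d

  right? : ∀ Γ Δ → Below G4WK ‖_‖ᵐ (‖ Γ ‖ᶜ + ‖ Δ ‖ᵐ) → Dec (Right Γ Δ)
  right? Γ (just (φ ∧' ψ)) below =
    below Γ (just φ) (+-monoʳ-< _ (‖‖-∧ˡ φ ψ)) ×-dec below Γ (just ψ) (+-monoʳ-< _ (‖‖-∧ʳ φ ψ))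
  right? Γ (just (φ ∨' ψ)) below =
    below Γ (just φ) (+-monoʳ-< _ (‖‖-∨ˡ φ ψ)) ⊎-dec below Γ (just ψ) (+-monoʳ-< _ (‖‖-∨ʳ φ ψ))
  right? Γ (just (φ ⇒ ψ)) below = below (φ ∷ Γ) (just ψ) (⇒R-lighter {Γ})
  right? Γ (just (□ φ)) below = below (boxInv Γ) (just φ) (□R-lighter {Γ})
  right? Γ (just (var _)) _ = no λ ()
  right? Γ (just ⊥') _ = no λ ()
  right? Γ (just (◇ _)) _ = no λ ()
  right? Γ nothing _ = no λ ()

  ◇L′? : ∀ Γ Δ → Below G4WK ‖_‖ᵐ (‖ Γ ‖ᶜ + ‖ Δ ‖ᵐ) → Dec (Pick (◇L′-premise Δ) Γ)
  ◇L′? Γ Δ below = pick? Γ premise?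
    where
    premise? : ∀ {B R} → Select Γ B R → Dec (◇L′-premise Δ B R)
    premise? {B} {R} s = onDiamond? B R λ where
      φ refl → below (φ ∷ boxInv R) (diaInv Δ) (◇L-lighter s (‖diaInv‖ᵐ≤ Δ))

  G4WK? : ∀ Γ Δ → Dec (G4WK Γ Δ)
  G4WK? = decidable-by-weight G4WK ‖_‖ᵐ λ Γ Δ below →
    map′ last-rule-sound last-rule
      (right? Γ Δ below ⊎-dec lefts? Γ Δ below ⊎-dec ◇L′? Γ Δ below)

proposition2 : ((Γ : List Fml) (φ : Fml) → Dec (G4CK Γ φ))
    × ((Γ : List Fml) (Δ : Maybe Fml) → Dec (G4WK Γ Δ))
proposition2 = CK.G4CK? , WK.G4WK?
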